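{- Let $G$ be a divisible design graph with parameters $(4n,n+2,n-2,2,4,n)$ whose canonical partition $V_1,V_2,V_3,V_4$ has quotient matrix $$\begin{pmatrix} 1&n-1&1&1\\ n-1&1&1&1\\ 1&1&1&n-1\\ 1&1&n-1&1\end{pmatrix},$$ and let $G^\ast$ be the graph obtained from $G$ by complementing all adjacencies between $V_1$ and $V_2$ and all adjacencies between $V_3$ and $V_4$ (other adjacencies unchanged). Then the number of vertices of every connected component of $G^\ast$ is divisible by $8$.
   Context: A divisible design graph (DDG) with parameters $(v,k,\lambda_1,\lambda_2,m,n)$ is a $k$-regular graph on $v=mn$ vertices whose vertex set can be partitioned into $m$ classes of size $n$ (a canonical partition) such that any two distinct vertices in the same class have exactly $\lambda_1$ common neighbours and any two vertices in different classes have exactly $\lambda_2$ common neighbours. The quotient matrix $(r_{ij})$ means every vertex of $V_i$ has exactly $r_{ij}$ neighbours in $V_j$. (In $G^\ast$ every vertex has exactly one neighbour in each $V_j$.) -}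

module Defs where

open import Data.Bool using (Bool; true; false; not; _∧_; if_then_else_; T)
open import Data.Nat using (ℕ; zero; suc; _+_; _∸_)
open import Data.Fin using (Fin; zero; suc)
open import Data.Fin.Properties using () renaming (_≟_ to _≟ᶠ_)
open import Data.Product using (_×_; _,_; proj₁; proj₂)
open import Data.List using (List; length; filterᵇ; cartesianProduct; allFin)
open import Relation.Nullary.Decidable using (⌊_⌋)
open import Relation.Binary.PropositionalEquality using (_≡_; _≢_)
open import Relation.Binary.Construct.Closure.ReflexiveTransitive using (Star)

-- Vertex set of a graph on 4n vertices, labelled so that the canonical
-- partition V_1..V_4 is given by the first component (class index 0..3).
V : ℕ → Set
V n = Fin 4 × Fin n

cls : ∀ {n} → V n → Fin 4
cls = proj₁

allV : (n : ℕ) → List (V n)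
allV n = cartesianProduct (allFin 4) (allFin n)

countV : (n : ℕ) → (V n → Bool) → ℕ
countV n P = length (filterᵇ P (allV n))

record Graph (n : ℕ) : Set where
  field
    adj   : V n → V n → Bool
    sym   : ∀ u w → adj u w ≡ adj w u
    irrefl : ∀ u → adj u u ≡ false
open Graph public

degree : ∀ {n} → Graph n → V n → ℕ
degree {n} G u = countV n (λ w → adj G u w)

commonNbrs : ∀ {n} → Graph n → V n → V n → ℕ
commonNbrs {n} G u v = countV n (λ w → adj G u w ∧ adj G v w)

nbrsIn : ∀ {n} → Graph n → V n → Fin 4 → ℕ
nbrsIn {n} G u j = countV n (λ w → adj G u w ∧ ⌊ cls w ≟ᶠ j ⌋)

-- G is a DDG with parameters (4n, k, λ1, λ2, 4, n) and canonical partition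
-- given by the classes V_i = { (i , a) }.
IsDDG : ∀ {n} → Graph n → ℕ → ℕ → ℕ → Set
IsDDG {n} G k l1 l2 =
  (∀ u → degree G u ≡ k) ×
  (∀ u v → u ≢ v → cls u ≡ cls v → commonNbrs G u v ≡ l1) ×
  (∀ u v → cls u ≢ cls v → commonNbrs G u v ≡ l2)

-- the quotient matrix from the statement (indices 0..3 for V_1..V_4)
R : ℕ → Fin 4 → Fin 4 → ℕ
R n zero zero = 1
R n zero (suc zero) = n ∸ 1
R n zero (suc (suc _)) = 1
R n (suc zero) zero = n ∸ 1
R n (suc zero) (suc zero) = 1
R n (suc zero) (suc (suc _)) = 1
R n (suc (suc zero)) zero = 1
R n (suc (suc zero)) (suc zero) = 1
R n (suc (suc zero)) (suc (suc zero)) = 1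
R n (suc (suc zero)) (suc (suc (suc zero))) = n ∸ 1
R n (suc (suc (suc zero))) zero = 1
R n (suc (suc (suc zero))) (suc zero) = 1
R n (suc (suc (suc zero))) (suc (suc zero)) = n ∸ 1
R n (suc (suc (suc zero))) (suc (suc (suc zero))) = 1

HasQuotient : ∀ {n} → Graph n → Set
HasQuotient {n} G = ∀ u j → nbrsIn G u j ≡ R n (cls u) j

partner : Fin 4 → Fin 4
partner zero = suc zero
partner (suc zero) = zero
partner (suc (suc zero)) = suc (suc (suc zero))
partner (suc (suc (suc zero))) = suc (suc zero)

adjStar : ∀ {n} → Graph n → V n → V n → Bool
adjStar G u w =
  if ⌊ partner (cls u) ≟ᶠ cls w ⌋ then not (adj G u w) else adj G u w

Reach* : ∀ {n} → Graph n → V n → V n → Set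
Reach* G = Star (λ u w → T (adjStar G u w))

{-# OPTIONS --safe #-}
-- In G* every vertex has exactly one neighbour in each class V_j: outside its partner
-- class nothing changed and the quotient matrix gives one G-neighbour there, while in the
-- partner class, of size n, complementing the n − 1 G-neighbours leaves exactly one.
-- Write ν_j x for that neighbour.  For x ∈ V_i we have ν_i (ν_j x) = x, so on any
-- adjacency-closed set of vertices (such as a component) ν_j is a bijection from the part
-- in V_i to the part in V_j, and ν_i is a fixed-point-free involution of the part in V_i.
-- Hence the four parts have a common even size, and the component has 4 · 2k vertices.
module Submission where

open import Defs hiding (sym)
open import Data.Bool using (Bool; true; false; not; _∧_; T)
open import Data.Bool.Properties using (∧-zeroʳ; T-∧)
open import Data.Fin using (Fin; zero; suc; toℕ)
open import Data.Fin.Properties using (toℕ-injective) renaming (_≟_ to _≟ᶠ_)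
open import Data.List using (List; []; _∷_; length; filterᵇ; allFin; map)
open import Data.Nat.ListAction using (sum)
open import Data.List.Membership.Propositional using (_∈_)
open import Data.List.Membership.Propositional.Properties
  using (∈-filter⁺; ∈-filter⁻; ∈-cartesianProduct⁺; ∈-allFin)
open import Data.List.Properties using (length-tabulate; length-removeAt′; filter-≐; map-cong)
open import Data.List.Relation.Unary.All using (lookup)
open import Data.List.Relation.Unary.AllPairs using (_∷_)
open import Data.List.Relation.Unary.Any using (here; there; _─_)
open import Data.List.Relation.Unary.Any.Properties using (singleton⁻)
open import Data.List.Relation.Unary.Unique.Propositional using (Unique)
open import Data.List.Relation.Unary.Unique.Propositional.Properties
  using (filter⁺; cartesianProduct⁺; allFin⁺)
open import Data.Nat using (ℕ; suc; _+_; _*_; _∸_; _≤_; _<_; z≤n; s≤s; _<?_)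
open import Data.Nat.Divisibility using (_∣_; divides; *-monoʳ-∣)
open import Data.Nat.Properties using (+-suc; *-suc; *-identityʳ; +-cancelʳ-≡; ≤-antisym; <-asym; <-cmp)
open import Data.Product using (_×_; _,_; proj₁; proj₂; ∃)
open import Data.Product.Properties using (×-≡,≡→≡)
open import Function using (_∘_)
open import Function.Bundles using (Equivalence)
open import Relation.Binary using (tri<; tri≈; tri>)
open import Relation.Binary.Construct.Closure.ReflexiveTransitive using (ε; _◅_; _◅◅_)
open import Relation.Binary.PropositionalEquality
  using (_≡_; _≢_; refl; sym; trans; cong; cong₂; subst; module ≡-Reasoning)
open import Relation.Nullary using (yes; no; contradiction)
open import Relation.Nullary.Decidable using (⌊_⌋; toWitness; fromWitness; toWitnessFalse; fromWitnessFalse)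
open import Relation.Nullary.Decidable.Core using (T?)

module _ {A : Set} where

  filterᵇ-cong : ∀ {p q : A → Bool} → (∀ x → p x ≡ q x) → ∀ xs → filterᵇ p xs ≡ filterᵇ q xs
  filterᵇ-cong {p} {q} p≗q =
    filter-≐ (T? ∘ p) (T? ∘ q) ((λ {x} → subst T (p≗q x)) , (λ {x} → subst T (sym (p≗q x))))

  length-filterᵇ-not : ∀ (p : A → Bool) xs →
    length (filterᵇ p xs) + length (filterᵇ (not ∘ p) xs) ≡ length xs
  length-filterᵇ-not p [] = refl
  length-filterᵇ-not p (x ∷ xs) with p x
  ... | true  = cong suc (length-filterᵇ-not p xs)
  ... | false = trans (+-suc _ _) (cong suc (length-filterᵇ-not p xs))

  length-filterᵇ-∧-not : ∀ (p q : A → Bool) xs →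
    length (filterᵇ (λ x → not (p x) ∧ q x) xs) + length (filterᵇ (λ x → p x ∧ q x) xs)
      ≡ length (filterᵇ q xs)
  length-filterᵇ-∧-not p q [] = refl
  length-filterᵇ-∧-not p q (x ∷ xs) with p x | q x
  ... | false | true  = cong suc (length-filterᵇ-∧-not p q xs)
  ... | true  | true  = trans (+-suc _ _) (cong suc (length-filterᵇ-∧-not p q xs))
  ... | false | false = length-filterᵇ-∧-not p q xs
  ... | true  | false = length-filterᵇ-∧-not p q xs

  length≡1⇒singleton : ∀ (xs : List A) → length xs ≡ 1 → ∃ λ x → xs ≡ x ∷ []
  length≡1⇒singleton (x ∷ []) refl = x , refl

  ∈-─ : ∀ {x y} {ys : List A} (x∈ys : x ∈ ys) → y ∈ ys → y ≢ x → y ∈ (ys ─ x∈ys)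
  ∈-─ (here refl) (here refl) y≢x = contradiction refl y≢x
  ∈-─ (here refl) (there y∈ys) _  = y∈ys
  ∈-─ (there _)   (here refl) _   = here refl
  ∈-─ (there x∈ys) (there y∈ys) y≢x = there (∈-─ x∈ys y∈ys y≢x)

length-≤-injection : ∀ {A B : Set} (f : A → B) {xs : List A} {ys : List B} → Unique xs →
  (∀ {x} → x ∈ xs → f x ∈ ys) →
  (∀ {x y} → x ∈ xs → y ∈ xs → f x ≡ f y → x ≡ y) →
  length xs ≤ length ys
length-≤-injection f {[]} _ _ _ = z≤n
length-≤-injection f {x ∷ xs} {ys} (x∉xs ∷ xs!) into inj =
  subst (suc (length xs) ≤_) (sym (length-removeAt′ ys _))
    (s≤s (length-≤-injection f xs! into′ (λ x∈ y∈ → inj (there x∈) (there y∈))))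
  where
  into′ : ∀ {y} → y ∈ xs → f y ∈ (ys ─ into (here refl))
  into′ y∈xs = ∈-─ (into (here refl)) (into (there y∈xs))
    (λ fy≡fx → lookup x∉xs y∈xs (sym (inj (there y∈xs) (here refl) fy≡fx)))

length-≡-inverses : ∀ {A B : Set} (f : A → B) (g : B → A) {xs : List A} {ys : List B} →
  Unique xs → Unique ys →
  (∀ {x} → x ∈ xs → f x ∈ ys) → (∀ {y} → y ∈ ys → g y ∈ xs) →
  (∀ {x} → x ∈ xs → g (f x) ≡ x) → (∀ {y} → y ∈ ys → f (g y) ≡ y) →
  length xs ≡ length ys
length-≡-inverses f g xs! ys! f-into g-into gf fg = ≤-antisym
  (length-≤-injection f xs! f-into (λ x∈ y∈ e → trans (sym (gf x∈)) (trans (cong g e) (gf y∈))))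
  (length-≤-injection g ys! g-into (λ x∈ y∈ e → trans (sym (fg x∈)) (trans (cong f e) (fg y∈))))

-- Orienting each orbit {x , g x} by the key, g swaps the ascending and descending elements.
2∣length-involution : ∀ {A : Set} (key : A → ℕ) (g : A → A) {xs : List A} → Unique xs →
  (∀ {x} → x ∈ xs → g x ∈ xs) → (∀ {x} → x ∈ xs → g (g x) ≡ x) →
  (∀ {x} → x ∈ xs → key x ≢ key (g x)) →
  2 ∣ length xs
2∣length-involution {A} key g {xs} xs! g-into gg key≢ =
  divides (length ups) (begin
    length xs                   ≡⟨ sym (length-filterᵇ-not ascends xs) ⟩
    length ups + length downs   ≡⟨ cong (length ups +_) (sym |ups|≡|downs|) ⟩
    length ups + length ups     ≡⟨ cong (length ups +_) (sym (*-identityʳ (length ups))) ⟩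
    length ups + length ups * 1 ≡⟨ sym (*-suc (length ups) 1) ⟩
    length ups * 2              ∎)
  where
  open ≡-Reasoning

  ascends : A → Bool
  ascends x = ⌊ key x <? key (g x) ⌋

  ups downs : List A
  ups   = filterᵇ ascends xs
  downs = filterᵇ (not ∘ ascends) xs

  ups→downs : ∀ {x} → x ∈ ups → g x ∈ downs
  ups→downs {x} x∈ups with x∈xs , up ← ∈-filter⁻ (T? ∘ ascends) x∈ups =
    ∈-filter⁺ (T? ∘ (not ∘ ascends)) (g-into x∈xs)
      (fromWitnessFalse λ down →
        <-asym (toWitness up) (subst (key (g x) <_) (cong key (gg x∈xs)) down))

  downs→ups : ∀ {x} → x ∈ downs → g x ∈ ups
  downs→ups {x} x∈downs with x∈xs , down ← ∈-filter⁻ (T? ∘ (not ∘ ascends)) x∈downs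
    with <-cmp (key x) (key (g x))
  ... | tri< lt _ _ = contradiction lt (toWitnessFalse down)
  ... | tri≈ _ eq _ = contradiction eq (key≢ x∈xs)
  ... | tri> _ _ gt = ∈-filter⁺ (T? ∘ ascends) (g-into x∈xs) 
      (fromWitness (subst (key (g x) <_) (sym (cong key (gg x∈xs))) gt))

  |ups|≡|downs| : length ups ≡ length downs
  |ups|≡|downs| = length-≡-inverses g g
    (filter⁺ (T? ∘ ascends) xs!) (filter⁺ (T? ∘ (not ∘ ascends)) xs!)
    ups→downs downs→ups
    (λ x∈ups → gg (proj₁ (∈-filter⁻ (T? ∘ ascends) x∈ups)))
    (λ x∈downs → gg (proj₁ (∈-filter⁻ (T? ∘ (not ∘ ascends)) x∈downs)))

inClass : ∀ {n} → Fin 4 → V n → Bool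
inClass j w = ⌊ cls w ≟ᶠ j ⌋

classPart : ∀ {n} → Fin 4 → List (V n) → List (V n)
classPart j = filterᵇ (inClass j)

∈-classPart⁺ : ∀ {n j} {xs : List (V n)} {w} → w ∈ xs → cls w ≡ j → w ∈ classPart j xs
∈-classPart⁺ {j = j} w∈xs refl = ∈-filter⁺ (T? ∘ inClass j) w∈xs (fromWitness refl)

∈-classPart⁻ : ∀ {n j} (xs : List (V n)) {w} → w ∈ classPart j xs → w ∈ xs × cls w ≡ j
∈-classPart⁻ {j = j} xs w∈ with w∈xs , w∈j ← ∈-filter⁻ (T? ∘ inClass j) {xs = xs} w∈ =
  w∈xs , toWitness w∈j

classPart-unique : ∀ {n} j {xs : List (V n)} → Unique xs → Unique (classPart j xs)
classPart-unique j {xs} = filter⁺ (T? ∘ inClass j) {xs}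

allV-complete : ∀ n (w : V n) → w ∈ allV n
allV-complete n (i , a) = ∈-cartesianProduct⁺ (∈-allFin i) (∈-allFin a)

allV-unique : ∀ n → Unique (allV n)
allV-unique n = cartesianProduct⁺ (allFin⁺ 4) (allFin⁺ n)

length-classPart-allV : ∀ n j → length (classPart j (allV n)) ≡ n
length-classPart-allV n j =
  trans (length-≡-inverses proj₂ (j ,_)
           (classPart-unique j (allV-unique n)) (allFin⁺ n)
           (λ {w} _ → ∈-allFin (proj₂ w))
           (λ {a} _ → ∈-classPart⁺ (allV-complete n (j , a)) refl)
           (λ w∈ → cong (_, _) (sym (proj₂ (∈-classPart⁻ (allV n) w∈))))
           (λ _ → refl))
        (length-tabulate (λ a → a))

length-by-class : ∀ {n} (xs : List (V n)) →
  length xs ≡ sum (map (λ j → length (classPart j xs)) (allFin 4))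
length-by-class [] = refl
length-by-class ((i , a) ∷ xs) = trans (cong suc (length-by-class xs)) (suc-in-class i)
  where
  c : Fin 4 → ℕ
  c j = length (classPart j xs)

  suc-in-class : ∀ i →
    suc (sum (map c (allFin 4))) ≡ sum (map (λ j → length (classPart j ((i , a) ∷ xs))) (allFin 4))
  suc-in-class zero = refl
  suc-in-class (suc zero) = sym (+-suc _ _)
  suc-in-class (suc (suc zero)) = trans (sym (+-suc _ _)) (cong (c zero +_) (sym (+-suc _ _)))
  suc-in-class (suc (suc (suc zero))) =
    trans (sym (+-suc _ _))
      (cong (c zero +_) (trans (sym (+-suc _ _)) (cong (c (suc zero) +_) (sym (+-suc _ _)))))

partner-involutive : ∀ i → partner (partner i) ≡ i
partner-involutive zero = refl
partner-involutive (suc zero) = refl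
partner-involutive (suc (suc zero)) = refl
partner-involutive (suc (suc (suc zero))) = refl

partner-irreflexive : ∀ i → partner i ≢ i
partner-irreflexive zero ()
partner-irreflexive (suc zero) ()
partner-irreflexive (suc (suc zero)) ()
partner-irreflexive (suc (suc (suc zero))) ()

R-partner : ∀ n i → R n i (partner i) ≡ n ∸ 1
R-partner n zero = refl
R-partner n (suc zero) = refl
R-partner n (suc (suc zero)) = refl
R-partner n (suc (suc (suc zero))) = refl

R-nonpartner : ∀ n i j → j ≢ partner i → R n i j ≡ 1
R-nonpartner n zero zero _ = refl
R-nonpartner n zero (suc zero) j≢ = contradiction refl j≢
R-nonpartner n zero (suc (suc _)) _ = refl
R-nonpartner n (suc zero) zero j≢ = contradiction refl j≢
R-nonpartner n (suc zero) (suc zero) _ = refl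
R-nonpartner n (suc zero) (suc (suc _)) _ = refl
R-nonpartner n (suc (suc zero)) zero _ = refl
R-nonpartner n (suc (suc zero)) (suc zero) _ = refl
R-nonpartner n (suc (suc zero)) (suc (suc zero)) _ = refl
R-nonpartner n (suc (suc zero)) (suc (suc (suc zero))) j≢ = contradiction refl j≢
R-nonpartner n (suc (suc (suc zero))) zero _ = refl
R-nonpartner n (suc (suc (suc zero))) (suc zero) _ = refl
R-nonpartner n (suc (suc (suc zero))) (suc (suc zero)) j≢ = contradiction refl j≢
R-nonpartner n (suc (suc (suc zero))) (suc (suc (suc zero))) _ = refl

module _ {n} (G : Graph n) where

  adjStar-partner : ∀ {u w} → cls w ≡ partner (cls u) → adjStar G u w ≡ not (adj G u w)
  adjStar-partner {u} {w} w∈partner with partner (cls u) ≟ᶠ cls w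
  ... | yes _ = refl
  ... | no w∉partner = contradiction (sym w∈partner) w∉partner

  adjStar-nonpartner : ∀ {u w} → cls w ≢ partner (cls u) → adjStar G u w ≡ adj G u w
  adjStar-nonpartner {u} {w} w∉partner with partner (cls u) ≟ᶠ cls w
  ... | yes w∈partner = contradiction (sym w∈partner) w∉partner
  ... | no _ = refl

  adjStar-sym : ∀ u w → adjStar G u w ≡ adjStar G w u
  adjStar-sym u w with partner (cls u) ≟ᶠ cls w | partner (cls w) ≟ᶠ cls u
  ... | yes _ | yes _ = cong not (Graph.sym G u w)
  ... | no _  | no _  = Graph.sym G u w
  ... | yes p | no q  = contradiction (trans (cong partner (sym p)) (partner-involutive _)) q
  ... | no p  | yes q = contradiction (trans (cong partner (sym q)) (partner-involutive _)) p

  adjStar-irrefl : ∀ u → adjStar G u u ≡ false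
  adjStar-irrefl u = trans (adjStar-nonpartner (λ e → partner-irreflexive _ (sym e))) (irrefl G u)

star : ∀ {n} → Graph n → Graph n
star G = record { adj = adjStar G ; sym = adjStar-sym G ; irrefl = adjStar-irrefl G }

∧-inClass-cong : ∀ {n} {p q : V n → Bool} j → (∀ {w} → cls w ≡ j → p w ≡ q w) →
  ∀ w → p w ∧ inClass j w ≡ q w ∧ inClass j w
∧-inClass-cong j p≗q w with cls w ≟ᶠ j
... | yes w∈j = cong (_∧ true) (p≗q w∈j)
... | no _    = trans (∧-zeroʳ _) (sym (∧-zeroʳ _))

-- The Fin n argument witnesses n ≥ 1, so n ∸ 1 is not truncated.
+∸1≡⇒≡1 : ∀ {n x} → Fin n → x + (n ∸ 1) ≡ n → x ≡ 1
+∸1≡⇒≡1 {suc m} {x} _ = +-cancelʳ-≡ m x 1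

nbrsIn-star : ∀ {n} {G : Graph n} → HasQuotient G → ∀ u j → nbrsIn (star G) u j ≡ 1
nbrsIn-star {n} {G} quotient u j with j ≟ᶠ partner (cls u)
... | no j≢partner = begin
  nbrsIn (star G) u j ≡⟨ cong length (filterᵇ-cong (∧-inClass-cong j λ w∈j → adjStar-nonpartner G
                           λ w∈partner → j≢partner (trans (sym w∈j) w∈partner)) (allV n)) ⟩
  nbrsIn G u j        ≡⟨ quotient u j ⟩
  R n (cls u) j       ≡⟨ R-nonpartner n (cls u) j j≢partner ⟩
  1                   ∎
  where open ≡-Reasoning
... | yes refl = +∸1≡⇒≡1 (proj₂ u) (begin
  nbrsIn (star G) u j + (n ∸ 1)
    ≡⟨ cong₂ _+_ (cong length (filterᵇ-cong (∧-inClass-cong j (adjStar-partner G)) (allV n)))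
                 (sym (trans (quotient u j) (R-partner n (cls u)))) ⟩
  length (filterᵇ (λ w → not (adj G u w) ∧ inClass j w) (allV n)) + nbrsIn G u j
    ≡⟨ length-filterᵇ-∧-not (adj G u) (inClass j) (allV n) ⟩
  length (classPart j (allV n))
    ≡⟨ length-classPart-allV n j ⟩
  n ∎)
  where open ≡-Reasoning

module OneNeighbourPerClass {n} (H : Graph n) (one : ∀ u j → nbrsIn H u j ≡ 1) where

  adjIn : V n → Fin 4 → V n → Bool
  adjIn u j w = adj H u w ∧ inClass j w

  nbrsInList : V n → Fin 4 → List (V n)
  nbrsInList u j = filterᵇ (adjIn u j) (allV n)

  private
    nbrsInList-singleton : ∀ u j → ∃ λ w → nbrsInList u j ≡ w ∷ []
    nbrsInList-singleton u j = length≡1⇒singleton (nbrsInList u j) (one u j)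

  nbr : V n → Fin 4 → V n
  nbr u j = proj₁ (nbrsInList-singleton u j)

  nbr∈nbrsInList : ∀ u j → nbr u j ∈ nbrsInList u j
  nbr∈nbrsInList u j = subst (nbr u j ∈_) (sym (proj₂ (nbrsInList-singleton u j))) (here refl)

  nbr-adj×cls : ∀ u j → T (adj H u (nbr u j)) × cls (nbr u j) ≡ j
  nbr-adj×cls u j
    with adjacent , in-j ←
           T-∧ .Equivalence.to (proj₂ (∈-filter⁻ (T? ∘ adjIn u j) {xs = allV n} (nbr∈nbrsInList u j)))
    = adjacent , toWitness in-j

  nbr-unique : ∀ {u j w} → cls w ≡ j → T (adj H u w) → w ≡ nbr u j
  nbr-unique {u} {j} {w} refl adjacent =
    singleton⁻ (subst (w ∈_) (proj₂ (nbrsInList-singleton u j))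
      (∈-filter⁺ (T? ∘ adjIn u j) (allV-complete n w) (T-∧ .Equivalence.from (adjacent , fromWitness refl))))

  nbr-nbr : ∀ {x i} j → cls x ≡ i → nbr (nbr x j) i ≡ x
  nbr-nbr {x} j x∈i =
    sym (nbr-unique x∈i (subst T (Graph.sym H x (nbr x j)) (proj₁ (nbr-adj×cls x j))))

  nbr-≢ : ∀ x j → nbr x j ≢ x
  nbr-≢ x j nbr≡x
    with () ← subst T (irrefl H x) (subst (T ∘ adj H x) nbr≡x (proj₁ (nbr-adj×cls x j)))

  module _ {xs : List (V n)} (xs! : Unique xs)
           (closed : ∀ {x y} → x ∈ xs → T (adj H x y) → y ∈ xs) where

    nbr-∈-classPart : ∀ {i x} j → x ∈ classPart i xs → nbr x j ∈ classPart j xs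
    nbr-∈-classPart {x = x} j x∈ =
      ∈-classPart⁺ (closed (proj₁ (∈-classPart⁻ xs x∈)) (proj₁ (nbr-adj×cls x j)))
                   (proj₂ (nbr-adj×cls x j))

    length-classPart-constant : ∀ i j → length (classPart i xs) ≡ length (classPart j xs)
    length-classPart-constant i j = length-≡-inverses (λ x → nbr x j) (λ y → nbr y i)
      (classPart-unique i xs!) (classPart-unique j xs!)
      (nbr-∈-classPart j) (nbr-∈-classPart i)
      (λ x∈ → nbr-nbr j (proj₂ (∈-classPart⁻ xs x∈)))
      (λ y∈ → nbr-nbr i (proj₂ (∈-classPart⁻ xs y∈)))

    2∣length-classPart : ∀ i → 2 ∣ length (classPart i xs)
    2∣length-classPart i = 2∣length-involution (toℕ ∘ proj₂) (λ x → nbr x i)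
      (classPart-unique i xs!) (nbr-∈-classPart i)
      (λ x∈ → nbr-nbr i (proj₂ (∈-classPart⁻ xs x∈)))
      λ {x} x∈ same-index → nbr-≢ x i (sym (×-≡,≡→≡
        (trans (proj₂ (∈-classPart⁻ xs x∈)) (sym (proj₂ (nbr-adj×cls x i))) ,
         toℕ-injective same-index)))

    8∣length : 8 ∣ length xs
    8∣length = subst (8 ∣_) (sym length≡4*classPart) (*-monoʳ-∣ 4 (2∣length-classPart zero))
      where
      length≡4*classPart : length xs ≡ 4 * length (classPart zero xs)
      length≡4*classPart = trans (length-by-class xs)
        (cong sum (map-cong (λ j → length-classPart-constant j zero) (allFin 4)))

lemma4 : (n : ℕ) (G : Graph n) →
    IsDDG G (n + 2) (n ∸ 2) 2 →
    HasQuotient G →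
    (u : V n) (comp : List (V n)) →
    Unique comp →
    (∀ w → (w ∈ comp → Reach* G u w) × (Reach* G u w → w ∈ comp)) →
    8 ∣ length comp
lemma4 n G _ quotient u comp comp! component =
  OneNeighbourPerClass.8∣length (star G) (nbrsIn-star {G = G} quotient) comp! closed
  where
  closed : ∀ {x y} → x ∈ comp → T (adjStar G x y) → y ∈ comp
  closed {x} {y} x∈ x~y = proj₂ (component y) (proj₁ (component x) x∈ ◅◅ (x~y ◅ ε))
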